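{- A class of Kripke frames is $\mathrm{ML}(\mathbin{\underline{\vee}})$-definable if and only if it is $\mathrm{ML}(\mathsf{A}^+)$-definable.
   Context: Fix a set $\Phi$ of propositional variables. $\mathrm{ML}$-formulas: $\varphi ::= p \mid \neg p \mid (\varphi\wedge\varphi)\mid(\varphi\vee\varphi)\mid\Diamond\varphi\mid\Box\varphi$, $p\in\Phi$. $\mathrm{ML}(\mathsf{A}^+)$ adds only the rule $\varphi::=\mathsf{A}\varphi$, interpreted in Kripke semantics by $\mathfrak{M},w\Vdash\mathsf{A}\varphi$ iff $\varphi$ is true at every point of $\mathfrak{M}$; a formula is valid in a model if true at all points. $\mathrm{ML}(\mathbin{\underline{\vee}})$ adds the rule $\varphi::=(\varphi\mathbin{\underline{\vee}}\varphi)$ and is interpreted in team semantics: for a model $\mathfrak{M}=(W,R,V)$ and $T\subseteq W$: $\mathfrak{M},T\models p$ iff $T\subseteq V(p)$; $\mathfrak{M},T\models\neg p$ iff $T\cap V(p)=\emptyset$; $\wedge$ conjunction; $\mathfrak{M},T\models\varphi\vee\psi$ iff $T=T_1\cup T_2$ with $\mathfrak{M},T_1\models\varphi$, $\mathfrak{M},T_2\models\psi$; $\mathfrak{M},T\models\Diamond\varphi$ iff $\mathfrak{M},T'\models\varphi$ for some $T'$ such that every point of $T$ has an $R$-successor in $T'$ and every point of $T'$ has an $R$-predecessor in $T$; $\mathfrak{M},T\models\Box\varphi$ iff $\mathfrak{M},R[T]\models\varphi$ with $R[T]$ the set of $R$-successors of points of $T$; $\mathfrak{M},T\models\varphi\mathbin{\underline{\vee}}\psi$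 iff $\mathfrak{M},T\models\varphi$ or $\mathfrak{M},T\models\psi$. Such a formula is valid in a model if every team satisfies it. A set of formulas is valid in a frame if valid in every model on that frame (every valuation); a class of frames is $L$-definable if it is the class of frames in which some set of $L$-formulas is valid. -}

module Defs where

open import Level using (0ℓ; Lift) renaming (suc to lsuc)
open import Data.Product using (Σ; ∃; _×_; _,_)
open import Data.Sum using (_⊎_)
open import Relation.Nullary using (¬_)
open import Function.Bundles using (_⇔_)

record Frame : Set₁ where
  field
    W : Set
    R : W → W → Set

open Frame public

Valuation : (Φ : Set) → Frame → Set₁
Valuation Φ F = Φ → W F → Set

FrameClass : Set₂
FrameClass = Frame → Set₁

-- ML(A⁺): ML (negation normal form) plus the global modality A.

data FormA (Φ : Set) : Set where
  var  : Φ → FormA Φ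
  nvar : Φ → FormA Φ
  _∧_  : FormA Φ → FormA Φ → FormA Φ
  _∨_  : FormA Φ → FormA Φ → FormA Φ
  ◇    : FormA Φ → FormA Φ
  □    : FormA Φ → FormA Φ
  A    : FormA Φ → FormA Φ

_,_,_⊩_ : {Φ : Set} (F : Frame) → Valuation Φ F → W F → FormA Φ → Set
F , V , w ⊩ var p  = V p w
F , V , w ⊩ nvar p = ¬ V p w
F , V , w ⊩ (φ ∧ ψ) = (F , V , w ⊩ φ) × (F , V , w ⊩ ψ)
F , V , w ⊩ (φ ∨ ψ) = (F , V , w ⊩ φ) ⊎ (F , V , w ⊩ ψ)
F , V , w ⊩ ◇ φ = ∃ λ v → R F w v × (F , V , v ⊩ φ)
F , V , w ⊩ □ φ = ∀ v → R F w v → F , V , v ⊩ φ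
F , V , w ⊩ A φ = ∀ v → F , V , v ⊩ φ

ValidA : {Φ : Set} (F : Frame) → FormA Φ → Set₁
ValidA F φ = ∀ V w → F , V , w ⊩ φ

ValidSetA : {Φ : Set} (F : Frame) → (FormA Φ → Set) → Set₁
ValidSetA F S = ∀ φ → S φ → ValidA F φ

DefinableA : (Φ : Set) → FrameClass → Set₁
DefinableA Φ C = Σ (FormA Φ → Set) λ S → ∀ F → C F ⇔ ValidSetA F S

-- ML(∨̲): ML (negation normal form) plus Boolean disjunction ∨̲,
-- interpreted in team semantics.  Teams are predicates W → Set.

data FormT (Φ : Set) : Set where
  var  : Φ → FormT Φ
  nvar : Φ → FormT Φ
  _∧_  : FormT Φ → FormT Φ → FormT Φ
  _∨_  : FormT Φ → FormT Φ → FormT Φ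
  ◇    : FormT Φ → FormT Φ
  □    : FormT Φ → FormT Φ
  _⩒_  : FormT Φ → FormT Φ → FormT Φ

Team : Frame → Set₁
Team F = W F → Set

Img : (F : Frame) → Team F → Team F
Img F T v = ∃ λ w → T w × R F w v

_,_,_⊨_ : {Φ : Set} (F : Frame) → Valuation Φ F → Team F → FormT Φ → Set₁
F , V , T ⊨ var p  = Lift (lsuc 0ℓ) (∀ w → T w → V p w)
F , V , T ⊨ nvar p = Lift (lsuc 0ℓ) (∀ w → T w → ¬ V p w)
F , V , T ⊨ (φ ∧ ψ) = (F , V , T ⊨ φ) × (F , V , T ⊨ ψ)
F , V , T ⊨ (φ ∨ ψ) =
  Σ (Team F) λ T₁ → Σ (Team F) λ T₂ →
    (∀ w → T w → T₁ w ⊎ T₂ w) × (∀ w → T₁ w → T w) × (∀ w → T₂ w → T w)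
    × (F , V , T₁ ⊨ φ) × (F , V , T₂ ⊨ ψ)
F , V , T ⊨ ◇ φ =
  Σ (Team F) λ T′ →
    (∀ w → T w → ∃ λ v → R F w v × T′ v)
    × (∀ v → T′ v → ∃ λ w → T w × R F w v)
    × (F , V , T′ ⊨ φ)
F , V , T ⊨ □ φ = F , V , Img F T ⊨ φ
F , V , T ⊨ (φ ⩒ ψ) = (F , V , T ⊨ φ) ⊎ (F , V , T ⊨ ψ)

ValidT : {Φ : Set} (F : Frame) → FormT Φ → Set₁
ValidT F φ = ∀ V T → F , V , T ⊨ φ

ValidSetT : {Φ : Set} (F : Frame) → (FormT Φ → Set) → Set₁
ValidSetT F S = ∀ φ → S φ → ValidT F φ

DefinableT : (Φ : Set) → FrameClass → Set₁
DefinableT Φ C = Σ (FormT Φ → Set) λ S → ∀ F → C F ⇔ ValidSetT F S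

-- On a fixed model both kinds of validity reduce to some basic modal formula being
-- true everywhere.  An ML(∨̲)-formula is team-equivalent to a Boolean disjunction of
-- ML-formulas, and ML-formulas are flat, so it is valid iff one of its disjuncts α is
-- true everywhere, i.e. iff ⋁ A α is valid.  An ML(A⁺)-formula is pointwise
-- equivalent to a disjunction of formulas A γ ∧ β with γ, β basic; at □ and A one
-- keeps (by excluded middle) exactly the disjuncts whose guard γ holds globally, so
-- validity becomes finitely many alternatives "γ₁ ∧ … ∧ (β₁ ∨ …) holds everywhere",
-- a Boolean disjunction of ML-formulas in team semantics.
module Submission where

open import Defs
open import Level using (0ℓ; lift; lower) renaming (suc to lsuc)
open import Axiom.ExcludedMiddle using (ExcludedMiddle)
open import Function.Base using (_∘_)
open import Function.Bundles using (_⇔_; mk⇔; Equivalence)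
open import Function.Construct.Composition using (_⇔-∘_)
open import Data.Bool.Base using (true; false)
open import Data.Empty using (⊥; ⊥-elim)
open import Data.Product using (∃; _×_; _,_; proj₁; proj₂)
open import Data.Sum using (_⊎_; inj₁; inj₂)
open import Data.Unit using (⊤; tt)
open import Data.List using (List; []; _∷_; _++_; map; filter; cartesianProductWith)
open import Data.List.Membership.Propositional using (_∈_)
open import Data.List.Membership.Propositional.Properties
open import Data.List.Relation.Binary.Subset.Propositional using (_⊆_)
open import Data.List.Relation.Unary.Any using (here; there)
open import Relation.Nullary using (¬_; Dec; yes; no; does)
open import Relation.Nullary.Decidable using (map′)
open import Relation.Unary using (Decidable; U)
open import Relation.Binary.PropositionalEquality using (_≡_; refl)

decide : ExcludedMiddle (lsuc 0ℓ) → (P : Set) → Dec P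
decide em P = map′ lower lift em

sublists : {X : Set} → List X → List (List X)
sublists []       = [] ∷ []
sublists (x ∷ xs) = map (x ∷_) (sublists xs) ++ sublists xs

[]∈sublists : {X : Set} (xs : List X) → [] ∈ sublists xs
[]∈sublists []       = here refl
[]∈sublists (x ∷ xs) = ∈-++⁺ʳ (map (x ∷_) (sublists xs)) ([]∈sublists xs)

∈-sublists⇒⊆ : {X : Set} (xs : List X) {ys : List X} → ys ∈ sublists xs → ys ⊆ xs
∈-sublists⇒⊆ []       (here refl) ()
∈-sublists⇒⊆ (x ∷ xs) ys∈ y∈ys with ∈-++⁻ (map (x ∷_) (sublists xs)) ys∈
... | inj₂ ys∈′ = there (∈-sublists⇒⊆ xs ys∈′ y∈ys)
... | inj₁ x∷zs∈ with ∈-map⁻ (x ∷_) x∷zs∈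
...   | zs , zs∈ , refl with y∈ys
...     | here y≡x   = here y≡x
...     | there y∈zs = there (∈-sublists⇒⊆ xs zs∈ y∈zs)

filter∈sublists : {X : Set} {P : X → Set} (P? : Decidable P) (xs : List X) →
                  filter P? xs ∈ sublists xs
filter∈sublists P? []       = here refl
filter∈sublists P? (x ∷ xs) with does (P? x)
... | true  = ∈-++⁺ˡ (∈-map⁺ (x ∷_) (filter∈sublists P? xs))
... | false = ∈-++⁺ʳ (map (x ∷_) (sublists xs)) (filter∈sublists P? xs)

∀-⇔ : ∀ {a b c} {X : Set a} {P : X → Set b} {Q : X → Set c} →
      (∀ x → P x ⇔ Q x) → (∀ x → P x) ⇔ (∀ x → Q x)
∀-⇔ P⇔Q = mk⇔ (λ h x → Equivalence.to (P⇔Q x) (h x)) (λ h x → Equivalence.from (P⇔Q x) (h x))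

Definable : {L : Set} → (Frame → L → Set₁) → FrameClass → Set₁
Definable {L} valid C = ∃ λ (S : L → Set) → ∀ F → C F ⇔ (∀ φ → S φ → valid F φ)

definable-transfer : {L L′ : Set} {valid : Frame → L → Set₁} {valid′ : Frame → L′ → Set₁}
                     (t : L → L′) → (∀ F φ → valid F φ ⇔ valid′ F (t φ)) →
                     ∀ C → Definable valid C → Definable valid′ C
definable-transfer {L′ = L′} {valid} {valid′} t valid⇔ C (S , C⇔) =
  image , λ F → mk⇔ (to F) (from F) ⇔-∘ C⇔ F
  where
  image : L′ → Set
  image ψ = ∃ λ φ → S φ × ψ ≡ t φ
  to : ∀ F → (∀ φ → S φ → valid F φ) → ∀ ψ → image ψ → valid′ F ψ
  to F h _ (φ , Sφ , refl) = Equivalence.to (valid⇔ F φ) (h φ Sφ)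
  from : ∀ F → (∀ ψ → image ψ → valid′ F ψ) → ∀ φ → S φ → valid F φ
  from F h φ Sφ = Equivalence.from (valid⇔ F φ) (h (t φ) (φ , Sφ , refl))

data Basic (Φ : Set) : Set where
  var nvar : Φ → Basic Φ
  ⊤ᴮ ⊥ᴮ    : Basic Φ
  _∧_ _∨_  : Basic Φ → Basic Φ → Basic Φ
  ◇ □      : Basic Φ → Basic Φ

-- Neither target language has constants, so ⊤ and ⊥ are written with a variable p;
-- p is taken from the formula being translated, as Φ may be empty.
embedT : {Φ : Set} → Φ → Basic Φ → FormT Φ
embedT p (var q)  = var q
embedT p (nvar q) = nvar q
embedT p ⊤ᴮ       = var p ∨ nvar p
embedT p ⊥ᴮ       = var p ∧ nvar p
embedT p (α ∧ β)  = embedT p α ∧ embedT p β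
embedT p (α ∨ β)  = embedT p α ∨ embedT p β
embedT p (◇ α)    = ◇ (embedT p α)
embedT p (□ α)    = □ (embedT p α)

embedA : {Φ : Set} → Φ → Basic Φ → FormA Φ
embedA p (var q)  = var q
embedA p (nvar q) = nvar q
embedA p ⊤ᴮ       = var p ∨ nvar p
embedA p ⊥ᴮ       = var p ∧ nvar p
embedA p (α ∧ β)  = embedA p α ∧ embedA p β
embedA p (α ∨ β)  = embedA p α ∨ embedA p β
embedA p (◇ α)    = ◇ (embedA p α)
embedA p (□ α)    = □ (embedA p α)

someThroughout : {Φ : Set} → Φ → List (Basic Φ) → FormT Φ
someThroughout p []       = embedT p ⊥ᴮ
someThroughout p (α ∷ αs) = embedT p α ⩒ someThroughout p αs

someGlobally : {Φ : Set} → Φ → List (Basic Φ) → FormA Φ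
someGlobally p []       = embedA p ⊥ᴮ
someGlobally p (α ∷ αs) = A (embedA p α) ∨ someGlobally p αs

disjuncts : {Φ : Set} → FormT Φ → List (Basic Φ)
disjuncts (var q)  = var q ∷ []
disjuncts (nvar q) = nvar q ∷ []
disjuncts (φ ∧ ψ)  = cartesianProductWith _∧_ (disjuncts φ) (disjuncts ψ)
disjuncts (φ ∨ ψ)  = cartesianProductWith _∨_ (disjuncts φ) (disjuncts ψ)
disjuncts (◇ φ)    = map ◇ (disjuncts φ)
disjuncts (□ φ)    = map □ (disjuncts φ)
disjuncts (φ ⩒ ψ)  = disjuncts φ ++ disjuncts ψ

disjuncts-nonempty : {Φ : Set} (φ : FormT Φ) → ∃ λ α → α ∈ disjuncts φ
disjuncts-nonempty (var q)  = _ , here refl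
disjuncts-nonempty (nvar q) = _ , here refl
disjuncts-nonempty (φ ∧ ψ)  =
  _ , ∈-cartesianProductWith⁺ _∧_ (proj₂ (disjuncts-nonempty φ)) (proj₂ (disjuncts-nonempty ψ))
disjuncts-nonempty (φ ∨ ψ)  =
  _ , ∈-cartesianProductWith⁺ _∨_ (proj₂ (disjuncts-nonempty φ)) (proj₂ (disjuncts-nonempty ψ))
disjuncts-nonempty (◇ φ)    = _ , ∈-map⁺ ◇ (proj₂ (disjuncts-nonempty φ))
disjuncts-nonempty (□ φ)    = _ , ∈-map⁺ □ (proj₂ (disjuncts-nonempty φ))
disjuncts-nonempty (φ ⩒ ψ)  = _ , ∈-++⁺ˡ (proj₂ (disjuncts-nonempty φ))

-- (γ , β) stands for A γ ∧ β.
Guarded : Set → Set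
Guarded Φ = Basic Φ × Basic Φ

guards : {Φ : Set} → List (Guarded Φ) → Basic Φ
guards []            = ⊤ᴮ
guards ((γ , _) ∷ S) = γ ∧ guards S

bodies : {Φ : Set} → List (Guarded Φ) → Basic Φ
bodies []            = ⊥ᴮ
bodies ((_ , β) ∷ S) = β ∨ bodies S

_∧ᴳ_ : {Φ : Set} → Guarded Φ → Guarded Φ → Guarded Φ
(γ , β) ∧ᴳ (γ′ , β′) = γ ∧ γ′ , β ∧ β′

◇ᴳ : {Φ : Set} → Guarded Φ → Guarded Φ
◇ᴳ (γ , β) = γ , ◇ β

□ᴳ : {Φ : Set} → List (Guarded Φ) → Guarded Φ
□ᴳ S = guards S , □ (bodies S)

Aᴳ : {Φ : Set} → List (Guarded Φ) → Guarded Φ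
Aᴳ S = guards S ∧ bodies S , ⊤ᴮ

guardedForms : {Φ : Set} → FormA Φ → List (Guarded Φ)
guardedForms (var q)  = (⊤ᴮ , var q) ∷ []
guardedForms (nvar q) = (⊤ᴮ , nvar q) ∷ []
guardedForms (φ ∧ ψ)  = cartesianProductWith _∧ᴳ_ (guardedForms φ) (guardedForms ψ)
guardedForms (φ ∨ ψ)  = guardedForms φ ++ guardedForms ψ
guardedForms (◇ φ)    = map ◇ᴳ (guardedForms φ)
guardedForms (□ φ)    = map □ᴳ (sublists (guardedForms φ))
guardedForms (A φ)    = map Aᴳ (sublists (guardedForms φ))

globalDisjuncts : {Φ : Set} → FormA Φ → List (Basic Φ)
globalDisjuncts ψ = map (proj₁ ∘ Aᴳ) (sublists (guardedForms ψ))

someVarT : {Φ : Set} → FormT Φ → Φ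
someVarT (var q)  = q
someVarT (nvar q) = q
someVarT (φ ∧ ψ)  = someVarT φ
someVarT (φ ∨ ψ)  = someVarT φ
someVarT (◇ φ)    = someVarT φ
someVarT (□ φ)    = someVarT φ
someVarT (φ ⩒ ψ)  = someVarT φ

someVarA : {Φ : Set} → FormA Φ → Φ
someVarA (var q)  = q
someVarA (nvar q) = q
someVarA (φ ∧ ψ)  = someVarA φ
someVarA (φ ∨ ψ)  = someVarA φ
someVarA (◇ φ)    = someVarA φ
someVarA (□ φ)    = someVarA φ
someVarA (A φ)    = someVarA φ

translateT : {Φ : Set} → FormT Φ → FormA Φ
translateT φ = someGlobally (someVarT φ) (disjuncts φ)

translateA : {Φ : Set} → FormA Φ → FormT Φ
translateA ψ = someThroughout (someVarA ψ) (globalDisjuncts ψ)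

module Semantics {Φ : Set} (F : Frame) (V : Valuation Φ F) where

  infix 4 _⊩ᴮ_ _⊩ᴳ_ _⊩_ _⊨_

  _⊩ᴮ_ : W F → Basic Φ → Set
  w ⊩ᴮ var q   = V q w
  w ⊩ᴮ nvar q  = ¬ V q w
  w ⊩ᴮ ⊤ᴮ      = ⊤
  w ⊩ᴮ ⊥ᴮ      = ⊥
  w ⊩ᴮ (α ∧ β) = w ⊩ᴮ α × w ⊩ᴮ β
  w ⊩ᴮ (α ∨ β) = w ⊩ᴮ α ⊎ w ⊩ᴮ β
  w ⊩ᴮ ◇ α     = ∃ λ v → R F w v × v ⊩ᴮ α
  w ⊩ᴮ □ α     = ∀ v → R F w v → v ⊩ᴮ α

  Globally : Basic Φ → Set
  Globally α = ∀ w → w ⊩ᴮ α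

  _⊩ᴳ_ : W F → Guarded Φ → Set
  w ⊩ᴳ (γ , β) = Globally γ × w ⊩ᴮ β

  _⊩_ : W F → FormA Φ → Set
  w ⊩ ψ = F , V , w ⊩ ψ

  _⊨_ : Team F → FormT Φ → Set₁
  T ⊨ φ = F , V , T ⊨ φ

  guards⁺ : ∀ {w} S → (∀ {e} → e ∈ S → w ⊩ᴮ proj₁ e) → w ⊩ᴮ guards S
  guards⁺ []      h = tt
  guards⁺ (e ∷ S) h = h (here refl) , guards⁺ S (h ∘ there)

  guards⁻ : ∀ {w} S → w ⊩ᴮ guards S → ∀ {e} → e ∈ S → w ⊩ᴮ proj₁ e
  guards⁻ (e ∷ S) (h , _) (here refl) = h
  guards⁻ (e ∷ S) (_ , h) (there e∈S) = guards⁻ S h e∈S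

  bodies⁺ : ∀ {w e S} → e ∈ S → w ⊩ᴮ proj₂ e → w ⊩ᴮ bodies S
  bodies⁺ (here refl) h = inj₁ h
  bodies⁺ (there e∈S) h = inj₂ (bodies⁺ e∈S h)

  bodies⁻ : ∀ {w} S → w ⊩ᴮ bodies S → ∃ λ e → e ∈ S × w ⊩ᴮ proj₂ e
  bodies⁻ (e ∷ S) (inj₁ h) = e , here refl , h
  bodies⁻ (e ∷ S) (inj₂ h) with bodies⁻ S h
  ... | e′ , e′∈S , h′ = e′ , there e′∈S , h′

  ∧ᴳ⁺ : ∀ {w} e e′ → w ⊩ᴳ e → w ⊩ᴳ e′ → w ⊩ᴳ e ∧ᴳ e′
  ∧ᴳ⁺ e e′ (g , b) (g′ , b′) = (λ v → g v , g′ v) , b , b′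

  ∧ᴳ⁻ : ∀ {w} e e′ → w ⊩ᴳ e ∧ᴳ e′ → w ⊩ᴳ e × w ⊩ᴳ e′
  ∧ᴳ⁻ e e′ (g , b , b′) = (proj₁ ∘ g , b) , (proj₂ ∘ g , b′)

  module _ (p : Φ) where

    embedT-flat⁻ : ∀ α T → T ⊨ embedT p α → ∀ w → T w → w ⊩ᴮ α
    embedT-flat⁻ (var q)  T (lift h) = h
    embedT-flat⁻ (nvar q) T (lift h) = h
    embedT-flat⁻ ⊤ᴮ       T _ w _ = tt
    embedT-flat⁻ ⊥ᴮ       T (lift h , lift h′) w t = h′ w t (h w t)
    embedT-flat⁻ (α ∧ β)  T (h , h′) w t = embedT-flat⁻ α T h w t , embedT-flat⁻ β T h′ w t
    embedT-flat⁻ (α ∨ β)  T (T₁ , T₂ , split , _ , _ , h₁ , h₂) w t with split w t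
    ... | inj₁ t₁ = inj₁ (embedT-flat⁻ α T₁ h₁ w t₁)
    ... | inj₂ t₂ = inj₂ (embedT-flat⁻ β T₂ h₂ w t₂)
    embedT-flat⁻ (◇ α)    T (T′ , forth , _ , h) w t with forth w t
    ... | v , r , t′ = v , r , embedT-flat⁻ α T′ h v t′
    embedT-flat⁻ (□ α)    T h w t v r = embedT-flat⁻ α (Img F T) h v (w , t , r)

    embedA⁻ : ∀ α w → w ⊩ embedA p α → w ⊩ᴮ α
    embedA⁻ (var q)  w h = h
    embedA⁻ (nvar q) w h = h
    embedA⁻ ⊤ᴮ       w h = tt
    embedA⁻ ⊥ᴮ       w (h , h′) = h′ h
    embedA⁻ (α ∧ β)  w (h , h′) = embedA⁻ α w h , embedA⁻ β w h′
    embedA⁻ (α ∨ β)  w (inj₁ h) = inj₁ (embedA⁻ α w h)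
    embedA⁻ (α ∨ β)  w (inj₂ h) = inj₂ (embedA⁻ β w h)
    embedA⁻ (◇ α)    w (v , r , h) = v , r , embedA⁻ α v h
    embedA⁻ (□ α)    w h v r = embedA⁻ α v (h v r)

    module _ (em : ExcludedMiddle (lsuc 0ℓ)) where

      embedT-flat⁺ : ∀ α T → (∀ w → T w → w ⊩ᴮ α) → T ⊨ embedT p α
      embedT-flat⁺ (var q)  T h = lift h
      embedT-flat⁺ (nvar q) T h = lift h
      embedT-flat⁺ ⊤ᴮ       T _ = T₁ , T₂ , split , (λ _ → proj₁) , (λ _ → proj₁) ,
                                  lift (λ _ → proj₂) , lift (λ _ → proj₂)
        where
        T₁ T₂ : Team F
        T₁ w = T w × V p w
        T₂ w = T w × ¬ V p w
        split : ∀ w → T w → T₁ w ⊎ T₂ w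
        split w t with decide em (V p w)
        ... | yes x = inj₁ (t , x)
        ... | no ¬x = inj₂ (t , ¬x)
      embedT-flat⁺ ⊥ᴮ       T h = lift (λ w → ⊥-elim ∘ h w) , lift (λ w → ⊥-elim ∘ h w)
      embedT-flat⁺ (α ∧ β)  T h =
        embedT-flat⁺ α T (λ w → proj₁ ∘ h w) , embedT-flat⁺ β T (λ w → proj₂ ∘ h w)
      embedT-flat⁺ (α ∨ β)  T h = T₁ , T₂ , split , (λ _ → proj₁) , (λ _ → proj₁) ,
                                  embedT-flat⁺ α T₁ (λ _ → proj₂) , embedT-flat⁺ β T₂ (λ _ → proj₂)
        where
        T₁ T₂ : Team F
        T₁ w = T w × w ⊩ᴮ α
        T₂ w = T w × w ⊩ᴮ β
        split : ∀ w → T w → T₁ w ⊎ T₂ w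
        split w t with h w t
        ... | inj₁ x = inj₁ (t , x)
        ... | inj₂ y = inj₂ (t , y)
      embedT-flat⁺ (◇ α)    T h =
        T′ , forth , back , embedT-flat⁺ α T′ (λ { _ (_ , _ , _ , x) → x })
        where
        T′ : Team F
        T′ v = ∃ λ w → T w × R F w v × v ⊩ᴮ α
        forth : ∀ w → T w → ∃ λ v → R F w v × T′ v
        forth w t with h w t
        ... | v , r , x = v , r , w , t , r , x
        back : ∀ v → T′ v → ∃ λ w → T w × R F w v
        back v (w , t , r , _) = w , t , r
      embedT-flat⁺ (□ α)    T h = embedT-flat⁺ α (Img F T) (λ { v (w , t , r) → h w t v r })

      embedA⁺ : ∀ α w → w ⊩ᴮ α → w ⊩ embedA p α
      embedA⁺ (var q)  w h = h
      embedA⁺ (nvar q) w h = h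
      embedA⁺ ⊤ᴮ       w _ with decide em (V p w)
      ... | yes x = inj₁ x
      ... | no ¬x = inj₂ ¬x
      embedA⁺ (α ∧ β)  w (h , h′) = embedA⁺ α w h , embedA⁺ β w h′
      embedA⁺ (α ∨ β)  w (inj₁ h) = inj₁ (embedA⁺ α w h)
      embedA⁺ (α ∨ β)  w (inj₂ h) = inj₂ (embedA⁺ β w h)
      embedA⁺ (◇ α)    w (v , r , h) = v , r , embedA⁺ α v h
      embedA⁺ (□ α)    w h v r = embedA⁺ α v (h v r)

    ⊨⇒disjunct : ∀ φ T → T ⊨ φ → ∃ λ α → α ∈ disjuncts φ × T ⊨ embedT p α
    ⊨⇒disjunct (var q)  T h = var q , here refl , h
    ⊨⇒disjunct (nvar q) T h = nvar q , here refl , h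
    ⊨⇒disjunct (φ ∧ ψ)  T (h , h′) with ⊨⇒disjunct φ T h | ⊨⇒disjunct ψ T h′
    ... | α , α∈ , s | β , β∈ , s′ = α ∧ β , ∈-cartesianProductWith⁺ _∧_ α∈ β∈ , s , s′
    ⊨⇒disjunct (φ ∨ ψ)  T (T₁ , T₂ , split , ⊆₁ , ⊆₂ , h₁ , h₂)
      with ⊨⇒disjunct φ T₁ h₁ | ⊨⇒disjunct ψ T₂ h₂
    ... | α , α∈ , s | β , β∈ , s′ =
      α ∨ β , ∈-cartesianProductWith⁺ _∨_ α∈ β∈ , T₁ , T₂ , split , ⊆₁ , ⊆₂ , s , s′
    ⊨⇒disjunct (◇ φ)    T (T′ , forth , back , h) with ⊨⇒disjunct φ T′ h
    ... | α , α∈ , s = ◇ α , ∈-map⁺ ◇ α∈ , T′ , forth , back , s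
    ⊨⇒disjunct (□ φ)    T h with ⊨⇒disjunct φ (Img F T) h
    ... | α , α∈ , s = □ α , ∈-map⁺ □ α∈ , s
    ⊨⇒disjunct (φ ⩒ ψ)  T (inj₁ h) with ⊨⇒disjunct φ T h
    ... | α , α∈ , s = α , ∈-++⁺ˡ α∈ , s
    ⊨⇒disjunct (φ ⩒ ψ)  T (inj₂ h) with ⊨⇒disjunct ψ T h
    ... | α , α∈ , s = α , ∈-++⁺ʳ (disjuncts φ) α∈ , s

    disjunct⇒⊨ : ∀ φ T {α} → α ∈ disjuncts φ → T ⊨ embedT p α → T ⊨ φ
    disjunct⇒⊨ (var q)  T (here refl) h = h
    disjunct⇒⊨ (nvar q) T (here refl) h = h
    disjunct⇒⊨ (φ ∧ ψ)  T α∈ h with ∈-cartesianProductWith⁻ _∧_ (disjuncts φ) (disjuncts ψ) α∈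
    ... | _ , _ , α∈′ , β∈ , refl = disjunct⇒⊨ φ T α∈′ (proj₁ h) , disjunct⇒⊨ ψ T β∈ (proj₂ h)
    disjunct⇒⊨ (φ ∨ ψ)  T α∈ h with ∈-cartesianProductWith⁻ _∨_ (disjuncts φ) (disjuncts ψ) α∈
    ... | _ , _ , α∈′ , β∈ , refl with h
    ...   | T₁ , T₂ , split , ⊆₁ , ⊆₂ , s , s′ =
      T₁ , T₂ , split , ⊆₁ , ⊆₂ , disjunct⇒⊨ φ T₁ α∈′ s , disjunct⇒⊨ ψ T₂ β∈ s′
    disjunct⇒⊨ (◇ φ)    T α∈ h with ∈-map⁻ ◇ α∈
    ... | _ , α∈′ , refl with h
    ...   | T′ , forth , back , s = T′ , forth , back , disjunct⇒⊨ φ T′ α∈′ s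
    disjunct⇒⊨ (□ φ)    T α∈ h with ∈-map⁻ □ α∈
    ... | _ , α∈′ , refl = disjunct⇒⊨ φ (Img F T) α∈′ h
    disjunct⇒⊨ (φ ⩒ ψ)  T α∈ h with ∈-++⁻ (disjuncts φ) α∈
    ... | inj₁ α∈φ = inj₁ (disjunct⇒⊨ φ T α∈φ h)
    ... | inj₂ α∈ψ = inj₂ (disjunct⇒⊨ ψ T α∈ψ h)

    ⊨someThroughout⁺ : ∀ {α αs} T → α ∈ αs → T ⊨ embedT p α → T ⊨ someThroughout p αs
    ⊨someThroughout⁺ T (here refl) h = inj₁ h
    ⊨someThroughout⁺ T (there α∈) h = inj₂ (⊨someThroughout⁺ T α∈ h)

    ⊨someThroughout⁻ : ∀ αs T → T ⊨ someThroughout p αs →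
                       (∃ λ α → α ∈ αs × T ⊨ embedT p α) ⊎ T ⊨ embedT p ⊥ᴮ
    ⊨someThroughout⁻ []       T h = inj₂ h
    ⊨someThroughout⁻ (α ∷ αs) T (inj₁ h) = inj₁ (α , here refl , h)
    ⊨someThroughout⁻ (α ∷ αs) T (inj₂ h) with ⊨someThroughout⁻ αs T h
    ... | inj₁ (β , β∈ , s) = inj₁ (β , there β∈ , s)
    ... | inj₂ s = inj₂ s

    ⊩someGlobally⁻ : ∀ αs w → w ⊩ someGlobally p αs → ∃ λ α → α ∈ αs × Globally α
    ⊩someGlobally⁻ []       w h = ⊥-elim (embedA⁻ ⊥ᴮ w h)
    ⊩someGlobally⁻ (α ∷ αs) w (inj₁ h) = α , here refl , λ v → embedA⁻ α v (h v)
    ⊩someGlobally⁻ (α ∷ αs) w (inj₂ h) with ⊩someGlobally⁻ αs w h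
    ... | β , β∈ , g = β , there β∈ , g

    module _ (em : ExcludedMiddle (lsuc 0ℓ)) where

      ⊩someGlobally⁺ : ∀ {α αs} → α ∈ αs → Globally α → ∀ w → w ⊩ someGlobally p αs
      ⊩someGlobally⁺ {α} (here refl) g w = inj₁ (λ v → embedA⁺ em α v (g v))
      ⊩someGlobally⁺ (there α∈) g w = inj₂ (⊩someGlobally⁺ α∈ g w)

      -- The witness α₀ covers the empty frame, where every formula is valid.
      validSomeGlobally⇔ : ∀ {α₀ αs} → α₀ ∈ αs →
                           (∃ λ α → α ∈ αs × Globally α) ⇔ (∀ w → w ⊩ someGlobally p αs)
      validSomeGlobally⇔ {α₀} {αs} α₀∈ =
        mk⇔ (λ (α , α∈ , g) → ⊩someGlobally⁺ α∈ g) from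
        where
        from : (∀ w → w ⊩ someGlobally p αs) → ∃ λ α → α ∈ αs × Globally α
        from h with decide em (W F)
        ... | yes w = ⊩someGlobally⁻ αs w (h w)
        ... | no ¬w = α₀ , α₀∈ , ⊥-elim ∘ ¬w

      validSomeThroughout⇔ : ∀ {α₀ αs} → α₀ ∈ αs →
                             (∃ λ α → α ∈ αs × Globally α) ⇔ (∀ T → T ⊨ someThroughout p αs)
      validSomeThroughout⇔ {α₀} {αs} α₀∈ = mk⇔ to from
        where
        to : (∃ λ α → α ∈ αs × Globally α) → ∀ T → T ⊨ someThroughout p αs
        to (α , α∈ , g) T = ⊨someThroughout⁺ T α∈ (embedT-flat⁺ em α T (λ w _ → g w))
        from : (∀ T → T ⊨ someThroughout p αs) → ∃ λ α → α ∈ αs × Globally α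
        from h with ⊨someThroughout⁻ αs U (h U)
        ... | inj₁ (α , α∈ , s) = α , α∈ , λ w → embedT-flat⁻ α U s w tt
        ... | inj₂ s = α₀ , α₀∈ , λ w → ⊥-elim (embedT-flat⁻ ⊥ᴮ U s w tt)

      validT⇔ : ∀ φ → (∀ T → T ⊨ φ) ⇔ (∃ λ α → α ∈ disjuncts φ × Globally α)
      validT⇔ φ = mk⇔ to from
        where
        to : (∀ T → T ⊨ φ) → ∃ λ α → α ∈ disjuncts φ × Globally α
        to h with ⊨⇒disjunct φ U (h U)
        ... | α , α∈ , s = α , α∈ , λ w → embedT-flat⁻ α U s w tt
        from : (∃ λ α → α ∈ disjuncts φ × Globally α) → ∀ T → T ⊨ φ
        from (α , α∈ , g) T = disjunct⇒⊨ φ T α∈ (embedT-flat⁺ em α T (λ w _ → g w))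

  Covered : (W F → Set) → List (Guarded Φ) → Set
  Covered P xs = ∀ w → P w → ∃ λ e → e ∈ xs × w ⊩ᴳ e

  Selected : (W F → Set) → List (Guarded Φ) → List (Guarded Φ) → Set
  Selected P xs S = S ∈ sublists xs × Globally (guards S) × (∀ w → P w → w ⊩ᴮ bodies S)

  selected⇒covered : ∀ P xs {S} → Selected P xs S → Covered P xs
  selected⇒covered P xs {S} (S∈ , g , b) w Pw with bodies⁻ S (b w Pw)
  ... | e , e∈S , β = e , ∈-sublists⇒⊆ xs S∈ e∈S , (λ v → guards⁻ S (g v) e∈S) , β

  covered⇒selected : ExcludedMiddle (lsuc 0ℓ) → ∀ P xs → Covered P xs → ∃ (Selected P xs)
  covered⇒selected em P xs covered = S , filter∈sublists globally? xs , g , b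
    where
    globally? : Decidable (Globally ∘ proj₁)
    globally? e = decide em (Globally (proj₁ e))
    S : List (Guarded Φ)
    S = filter globally? xs
    g : Globally (guards S)
    g w = guards⁺ S (λ e∈S → proj₂ (∈-filter⁻ globally? {xs = xs} e∈S) w)
    b : ∀ w → P w → w ⊩ᴮ bodies S
    b w Pw with covered w Pw
    ... | e , e∈xs , g , β = bodies⁺ (∈-filter⁺ globally? e∈xs g) β

  ⊩⇒guarded : ExcludedMiddle (lsuc 0ℓ) → ∀ ψ w → w ⊩ ψ → ∃ λ e → e ∈ guardedForms ψ × w ⊩ᴳ e
  ⊩⇒guarded em (var q)  w h = _ , here refl , (λ _ → tt) , h
  ⊩⇒guarded em (nvar q) w h = _ , here refl , (λ _ → tt) , h
  ⊩⇒guarded em (φ ∧ ψ)  w (h , h′) with ⊩⇒guarded em φ w h | ⊩⇒guarded em ψ w h′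
  ... | e , e∈ , s | e′ , e′∈ , s′ = e ∧ᴳ e′ , ∈-cartesianProductWith⁺ _∧ᴳ_ e∈ e′∈ , ∧ᴳ⁺ e e′ s s′
  ⊩⇒guarded em (φ ∨ ψ)  w (inj₁ h) with ⊩⇒guarded em φ w h
  ... | e , e∈ , s = e , ∈-++⁺ˡ e∈ , s
  ⊩⇒guarded em (φ ∨ ψ)  w (inj₂ h) with ⊩⇒guarded em ψ w h
  ... | e , e∈ , s = e , ∈-++⁺ʳ (guardedForms φ) e∈ , s
  ⊩⇒guarded em (◇ φ)    w (v , r , h) with ⊩⇒guarded em φ v h
  ... | e , e∈ , g , b = ◇ᴳ e , ∈-map⁺ ◇ᴳ e∈ , g , v , r , b
  ⊩⇒guarded em (□ φ)    w h
    with covered⇒selected em (R F w) (guardedForms φ) (λ v r → ⊩⇒guarded em φ v (h v r))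
  ... | S , S∈ , g , b = □ᴳ S , ∈-map⁺ □ᴳ S∈ , g , b
  ⊩⇒guarded em (A φ)    w h
    with covered⇒selected em U (guardedForms φ) (λ v _ → ⊩⇒guarded em φ v (h v))
  ... | S , S∈ , g , b = Aᴳ S , ∈-map⁺ Aᴳ S∈ , (λ v → g v , b v tt) , tt

  guarded⇒⊩ : ∀ ψ w {e} → e ∈ guardedForms ψ → w ⊩ᴳ e → w ⊩ ψ
  guarded⇒⊩ (var q)  w (here refl) (_ , b) = b
  guarded⇒⊩ (nvar q) w (here refl) (_ , b) = b
  guarded⇒⊩ (φ ∧ ψ)  w e∈ s
    with ∈-cartesianProductWith⁻ _∧ᴳ_ (guardedForms φ) (guardedForms ψ) e∈
  ... | e , e′ , e∈φ , e′∈ψ , refl with ∧ᴳ⁻ e e′ s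
  ...   | s₁ , s₂ = guarded⇒⊩ φ w e∈φ s₁ , guarded⇒⊩ ψ w e′∈ψ s₂
  guarded⇒⊩ (φ ∨ ψ)  w e∈ s with ∈-++⁻ (guardedForms φ) e∈
  ... | inj₁ e∈φ = inj₁ (guarded⇒⊩ φ w e∈φ s)
  ... | inj₂ e∈ψ = inj₂ (guarded⇒⊩ ψ w e∈ψ s)
  guarded⇒⊩ (◇ φ)    w e∈ s with ∈-map⁻ ◇ᴳ e∈
  ... | e , e∈φ , refl with s
  ...   | g , v , r , b = v , r , guarded⇒⊩ φ v e∈φ (g , b)
  guarded⇒⊩ (□ φ)    w e∈ s with ∈-map⁻ □ᴳ e∈
  ... | S , S∈ , refl = λ v r →
    let e , e∈φ , s′ = selected⇒covered (R F w) (guardedForms φ) (S∈ , s) v r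
    in guarded⇒⊩ φ v e∈φ s′
  guarded⇒⊩ (A φ)    w e∈ (g , _) with ∈-map⁻ Aᴳ e∈
  ... | S , S∈ , refl = λ v →
    let e , e∈φ , s′ =
          selected⇒covered U (guardedForms φ) (S∈ , proj₁ ∘ g , λ u _ → proj₂ (g u)) v tt
    in guarded⇒⊩ φ v e∈φ s′

  validA⇔ : ExcludedMiddle (lsuc 0ℓ) →
            ∀ ψ → (∀ w → w ⊩ ψ) ⇔ (∃ λ α → α ∈ globalDisjuncts ψ × Globally α)
  validA⇔ em ψ = mk⇔ to from
    where
    to : (∀ w → w ⊩ ψ) → ∃ λ α → α ∈ globalDisjuncts ψ × Globally α
    to h with covered⇒selected em U (guardedForms ψ) (λ w _ → ⊩⇒guarded em ψ w (h w))
    ... | S , S∈ , g , b = _ , ∈-map⁺ (proj₁ ∘ Aᴳ) S∈ , λ w → g w , b w tt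
    from : (∃ λ α → α ∈ globalDisjuncts ψ × Globally α) → ∀ w → w ⊩ ψ
    from (α , α∈ , g) w with ∈-map⁻ (proj₁ ∘ Aᴳ) α∈
    ... | S , S∈ , refl
      with selected⇒covered U (guardedForms ψ) (S∈ , proj₁ ∘ g , λ v _ → proj₂ (g v)) w tt
    ...   | e , e∈ , s = guarded⇒⊩ ψ w e∈ s

  module _ (em : ExcludedMiddle (lsuc 0ℓ)) where

    validT⇔validA-translateT : ∀ φ → (∀ T → T ⊨ φ) ⇔ (∀ w → w ⊩ translateT φ)
    validT⇔validA-translateT φ =
      validSomeGlobally⇔ (someVarT φ) em (proj₂ (disjuncts-nonempty φ))
      ⇔-∘ validT⇔ (someVarT φ) em φ

    validA⇔validT-translateA : ∀ ψ → (∀ w → w ⊩ ψ) ⇔ (∀ T → T ⊨ translateA ψ)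
    validA⇔validT-translateA ψ =
      validSomeThroughout⇔ (someVarA ψ) em (∈-map⁺ (proj₁ ∘ Aᴳ) ([]∈sublists (guardedForms ψ)))
      ⇔-∘ validA⇔ em ψ

module _ (em : ExcludedMiddle (lsuc 0ℓ)) {Φ : Set} where

  ValidT⇔ValidA-translateT : ∀ F (φ : FormT Φ) → ValidT F φ ⇔ ValidA F (translateT φ)
  ValidT⇔ValidA-translateT F φ = ∀-⇔ λ V → Semantics.validT⇔validA-translateT F V em φ

  ValidA⇔ValidT-translateA : ∀ F (ψ : FormA Φ) → ValidA F ψ ⇔ ValidT F (translateA ψ)
  ValidA⇔ValidT-translateA F ψ = ∀-⇔ λ V → Semantics.validA⇔validT-translateA F V em ψ

theorem4 : ExcludedMiddle (lsuc 0ℓ) →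
           (Φ : Set) (C : FrameClass) → DefinableT Φ C ⇔ DefinableA Φ C
theorem4 em Φ C = mk⇔ (definable-transfer translateT (ValidT⇔ValidA-translateT em) C)
                      (definable-transfer translateA (ValidA⇔ValidT-translateA em) C)
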